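{- For all positive integers $n$ and all non-negative integers $k$, \[z(P_n;k)\ge \frac{k^2}{n+k^2}\binom{n}{k}.\]
   Context: $P_n$ is the path on $n$ vertices. Zero forcing: given a graph $G$ whose vertices are each colored blue or white, if a blue vertex $u$ has exactly one white neighbor $v$, then $v$ may be recolored blue; this rule is applied repeatedly. A set $B\subseteq V(G)$ is a zero forcing set of $G$ if, starting with exactly the vertices of $B$ blue, repeated application eventually colors all of $V(G)$ blue. $z(G;k)$ denotes the number of zero forcing sets of $G$ of size exactly $k$. -}

module Defs where

open import Data.Nat using (ℕ; suc; _+_)
open import Data.Fin using (Fin; toℕ)
open import Data.Fin.Subset using (Subset; _∈_; _∉_; ⊤; ∣_∣; inside)
open import Data.Vec using (_[_]≔_)
open import Data.List using (List; length)
import Data.List.Membership.Propositional as L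
open import Data.List.Relation.Unary.Unique.Propositional using (Unique)
open import Data.Product using (_×_; ∃)
open import Function.Bundles using (_⇔_)
open import Relation.Nullary using (¬_)
open import Relation.Binary.PropositionalEquality using (_≡_)
open import Relation.Binary.Construct.Closure.ReflexiveTransitive using (Star)

Graph : ℕ → Set₁
Graph n = Fin n → Fin n → Set

Path : (n : ℕ) → Graph n
Path n i j = (suc (toℕ i) ≡ toℕ j) Data.Sum.⊎ (suc (toℕ j) ≡ toℕ i)
  where import Data.Sum

-- One application of the color change rule: a blue vertex u whose only
-- white neighbour is v forces v to become blue.  Colorings are subsets
-- (inside = blue).
data Force {n : ℕ} (G : Graph n) (C : Subset n) : Subset n → Set where
  force : (u v : Fin n) → u ∈ C → v ∉ C → G u v →
          (∀ w → G u w → ¬ (w ≡ v) → w ∈ C) →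
          Force G C (C [ v ]≔ inside)

IsZeroForcingSet : {n : ℕ} → Graph n → Subset n → Set
IsZeroForcingSet G B = Star (Force G) B ⊤

-- "N = z(G;k)": N is the number of zero forcing sets of G of size exactly k,
-- i.e. N is the length of a duplicate-free list enumerating exactly them.
IsZCount : {n : ℕ} → Graph n → ℕ → ℕ → Set
IsZCount {n} G k N =
  ∃ λ (Ls : List (Subset n)) → Unique Ls × length Ls ≡ N ×
    (∀ S → (S L.∈ Ls) ⇔ ((∣ S ∣ ≡ k) × IsZeroForcingSet G S))

-- A k-set S fails to force P_n only if no colour change is possible at all from S: both
-- end vertices are white and no two blue vertices are adjacent. Otherwise a blue end
-- vertex, or two adjacent blue vertices, starts a chain of forces that sweeps to one end
-- of the path and then back to the other. Such stalled k-sets correspond to k-subsets of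
-- an (n-k-1)-path, so z(P_n;k) ≥ C(n,k) - C(m,k) with m = n-k-1, and it remains to show
-- (n + k²) C(m,k) ≤ n C(n,k). Since C(m,k)/C(n,k) is a product of k factors
-- (m-i)/(n-i) ≤ m/n, it is at most (m/n)^k, and Bernoulli's inequality gives
-- n^(k+1) = (m + (k+1))^(k+1) ≥ m^(k+1) + (k+1)² m^k ≥ (n + k²) m^k.
module Submission where

open import Defs
open import Data.Nat
open import Data.Nat.Properties
open import Data.Nat.Combinatorics using (_C_; nCk+nC[k+1]≡[n+1]C[k+1]; k>n⇒nCk≡0)
open import Data.Nat.Combinatorics.Base using (_P′_)
open import Data.Nat.Tactic.RingSolver using (solve-∀)
open import Algebra.Properties.CommutativeSemigroup *-commutativeSemigroup
  using (interchange; x∙yz≈y∙xz; xy∙z≈xz∙y)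
open import Data.Bool using (Bool; true; false; not)
open import Data.Bool.Properties using (T-not-≡)
open import Data.Fin using (Fin; toℕ; fromℕ<) renaming (zero to fzero; suc to fsuc)
open import Data.Fin.Properties using (toℕ-fromℕ<; toℕ-injective; toℕ<n)
open import Data.Fin.Subset using (Subset; Side; ⊥; ⊤; ∣_∣; inside; outside; _∈_; _∉_)
open import Data.Fin.Subset.Properties using (∣⊥∣≡0)
open import Data.Vec using ([]; _∷_; lookup; _[_]≔_)
open import Data.Vec.Properties using (∷-injectiveʳ; []=⇒lookup; lookup⇒[]=)
open import Data.List using (List; []; _∷_; _++_; map; length; filterᵇ)
open import Data.List.Properties using (length-++; length-map; filter-++; length-filter; length-removeAt′)
open import Data.List.Membership.Propositional using () renaming (_∈_ to _∈ₗ_)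
open import Data.List.Membership.Propositional.Properties using (∈-map⁻; ∈-filter⁻)
open import Data.List.Relation.Unary.Any using (here; there; _─_)
open import Data.List.Relation.Unary.All as All using (All; []; _∷_)
import Data.List.Relation.Unary.All.Properties as All
open import Data.List.Relation.Unary.AllPairs using ([]; _∷_)
open import Data.List.Relation.Unary.Unique.Propositional using (Unique)
import Data.List.Relation.Unary.Unique.Propositional.Properties as Unique
open import Data.List.Relation.Binary.Subset.Propositional using (_⊆_)
open import Data.List.Relation.Binary.Disjoint.Propositional using (Disjoint)
open import Data.Product using (∃; _×_; _,_)
open import Data.Sum using (_⊎_; inj₁; inj₂; map₂)
open import Data.Empty using (⊥-elim)
open import Function using (_∘_; Equivalence)
open import Relation.Nullary using (Dec; yes; no)
open import Relation.Nullary.Decidable using (T?)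
open import Relation.Binary.PropositionalEquality
open import Relation.Binary.Construct.Closure.ReflexiveTransitive using (Star; ε; _◅_; _◅◅_)

-- Binomial coefficients

[1+n]P′[1+k]≡[1+n]*nP′k : ∀ n k → suc n P′ suc k ≡ suc n * (n P′ k)
[1+n]P′[1+k]≡[1+n]*nP′k n zero    = refl
[1+n]P′[1+k]≡[1+n]*nP′k n (suc k) = begin
  (n ∸ k) * (suc n P′ suc k)    ≡⟨ cong ((n ∸ k) *_) ([1+n]P′[1+k]≡[1+n]*nP′k n k) ⟩
  (n ∸ k) * (suc n * (n P′ k))  ≡⟨ x∙yz≈y∙xz (n ∸ k) (suc n) (n P′ k) ⟩
  suc n * ((n ∸ k) * (n P′ k))  ∎
  where open ≡-Reasoning

n<k⇒nP′k≡0 : ∀ {n k} → n < k → n P′ k ≡ 0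
n<k⇒nP′k≡0 {k = suc k} (s≤s n≤k) rewrite m≤n⇒m∸n≡0 n≤k = refl

nCk*k!≡nP′k : ∀ n k → (n C k) * k ! ≡ n P′ k
nCk*k!≡nP′k zero    zero    = refl
nCk*k!≡nP′k zero    (suc k) = cong (_* (0 P′ k)) (sym (0∸n≡0 k))
nCk*k!≡nP′k (suc n) zero    = refl
nCk*k!≡nP′k (suc n) (suc k) = begin
  (suc n C suc k) * (suc k * k !)
    ≡⟨ cong (_* (suc k * k !)) (nCk+nC[k+1]≡[n+1]C[k+1] n k) ⟨
  ((n C k) + (n C suc k)) * (suc k * k !)
    ≡⟨ expand (n C k) (n C suc k) (suc k) (k !) ⟩
  suc k * ((n C k) * k !) + (n C suc k) * (suc k * k !)
    ≡⟨ cong₂ (λ x y → suc k * x + y) (nCk*k!≡nP′k n k) (nCk*k!≡nP′k n (suc k)) ⟩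
  suc k * (n P′ k) + (n ∸ k) * (n P′ k)
    ≡⟨ *-distribʳ-+ (n P′ k) (suc k) (n ∸ k) ⟨
  (suc k + (n ∸ k)) * (n P′ k)
    ≡⟨ collapse (k ≤? n) ⟩
  suc n * (n P′ k)
    ≡⟨ [1+n]P′[1+k]≡[1+n]*nP′k n k ⟨
  suc n P′ suc k
    ∎
  where
  open ≡-Reasoning
  expand : ∀ a b c d → (a + b) * (c * d) ≡ c * (a * d) + b * (c * d)
  expand = solve-∀
  collapse : Dec (k ≤ n) → (suc k + (n ∸ k)) * (n P′ k) ≡ suc n * (n P′ k)
  collapse (yes k≤n) = cong (λ x → suc x * (n P′ k)) (m+[n∸m]≡n k≤n)
  collapse (no k≰n)  rewrite n<k⇒nP′k≡0 (≰⇒> k≰n) | *-zeroʳ (suc k + (n ∸ k)) | *-zeroʳ (suc n) = refl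

mP′k*[m+c]^k≤m^k*[m+c]P′k : ∀ m c k → (m P′ k) * (m + c) ^ k ≤ m ^ k * ((m + c) P′ k)
mP′k*[m+c]^k≤m^k*[m+c]P′k m c zero    = ≤-refl
mP′k*[m+c]^k≤m^k*[m+c]P′k m c (suc k) = begin
  ((m ∸ k) * (m P′ k)) * ((m + c) * (m + c) ^ k)  ≡⟨ interchange (m ∸ k) (m P′ k) (m + c) ((m + c) ^ k) ⟩
  ((m ∸ k) * (m + c)) * ((m P′ k) * (m + c) ^ k)  ≤⟨ *-mono-≤ factor (mP′k*[m+c]^k≤m^k*[m+c]P′k m c k) ⟩
  (m * (m + c ∸ k)) * (m ^ k * ((m + c) P′ k))    ≡⟨ interchange m (m + c ∸ k) (m ^ k) ((m + c) P′ k) ⟩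
  (m * m ^ k) * ((m + c ∸ k) * ((m + c) P′ k))    ∎
  where
  open ≤-Reasoning
  factor : (m ∸ k) * (m + c) ≤ m * (m + c ∸ k)
  factor rewrite *-distribʳ-∸ (m + c) m k | *-distribˡ-∸ m (m + c) k =
    ∸-monoʳ-≤ (m * (m + c)) (≤-trans (≤-reflexive (*-comm m k)) (*-monoʳ-≤ k (m≤m+n m c)))

mCk*[m+c]^k≤m^k*[m+c]Ck : ∀ m c k → (m C k) * (m + c) ^ k ≤ m ^ k * ((m + c) C k)
mCk*[m+c]^k≤m^k*[m+c]Ck m c k = *-cancelʳ-≤ _ _ (k !) {{k !≢0}} (begin
  (m C k) * (m + c) ^ k * k !    ≡⟨ xy∙z≈xz∙y (m C k) ((m + c) ^ k) (k !) ⟩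
  (m C k) * k ! * (m + c) ^ k    ≡⟨ cong (_* (m + c) ^ k) (nCk*k!≡nP′k m k) ⟩
  (m P′ k) * (m + c) ^ k         ≤⟨ mP′k*[m+c]^k≤m^k*[m+c]P′k m c k ⟩
  m ^ k * ((m + c) P′ k)         ≡⟨ cong (m ^ k *_) (nCk*k!≡nP′k (m + c) k) ⟨
  m ^ k * (((m + c) C k) * k !)  ≡⟨ *-assoc (m ^ k) ((m + c) C k) (k !) ⟨
  m ^ k * ((m + c) C k) * k !    ∎)
  where open ≤-Reasoning

bernoulli : ∀ m c k → m ^ suc k + suc k * c * m ^ k ≤ (m + c) ^ suc k
bernoulli m c zero    = ≤-reflexive (base m c)
  where
  base : ∀ m c → m * 1 + 1 * c * 1 ≡ (m + c) * 1
  base = solve-∀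
bernoulli m c (suc k) = begin
  m * (m * m ^ k) + suc (suc k) * c * (m * m ^ k)                          ≤⟨ m≤m+n _ _ ⟩
  m * (m * m ^ k) + suc (suc k) * c * (m * m ^ k) + suc k * c * c * m ^ k  ≡⟨ regroup m c k (m ^ k) ⟩
  (m + c) * (m ^ suc k + suc k * c * m ^ k)                                ≤⟨ *-monoʳ-≤ (m + c) (bernoulli m c k) ⟩
  (m + c) * (m + c) ^ suc k                                                ∎
  where
  open ≤-Reasoning
  regroup : ∀ m c k x → m * (m * x) + suc (suc k) * c * (m * x) + suc k * c * c * x
                        ≡ (m + c) * (m * x + suc k * c * x)
  regroup = solve-∀

[n+k^2]*mCk≤n*nCk : ∀ {m k n} .{{_ : NonZero n}} → m + suc k ≡ n → (n + k ^ 2) * (m C k) ≤ n * (n C k)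
[n+k^2]*mCk≤n*nCk {m} {k} {n} refl = *-cancelʳ-≤ _ _ (n ^ k) {{m^n≢0 n k}} (begin
  (n + k ^ 2) * (m C k) * n ^ k    ≡⟨ *-assoc (n + k ^ 2) (m C k) (n ^ k) ⟩
  (n + k ^ 2) * ((m C k) * n ^ k)  ≤⟨ *-monoʳ-≤ (n + k ^ 2) (mCk*[m+c]^k≤m^k*[m+c]Ck m (suc k) k) ⟩
  (n + k ^ 2) * (m ^ k * (n C k))  ≡⟨ *-assoc (n + k ^ 2) (m ^ k) (n C k) ⟨
  (n + k ^ 2) * m ^ k * (n C k)    ≤⟨ *-monoˡ-≤ (n C k) [n+k^2]*m^k≤n^[k+1] ⟩
  n * n ^ k * (n C k)              ≡⟨ xy∙z≈xz∙y n (n ^ k) (n C k) ⟩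
  n * (n C k) * n ^ k              ∎)
  where
  open ≤-Reasoning
  -- k ^ 2 written out as k * (k * 1), the form the ring solver can normalise
  square : ∀ m k → m + suc k + k * (k * 1) + k ≡ m + suc k * suc k
  square = solve-∀
  expand : ∀ m k x → (m + suc k * suc k) * x ≡ m * x + suc k * suc k * x
  expand = solve-∀
  n+k^2≤m+[1+k]^2 : n + k ^ 2 ≤ m + suc k * suc k
  n+k^2≤m+[1+k]^2 = ≤-trans (m≤m+n _ k) (≤-reflexive (square m k))
  [n+k^2]*m^k≤n^[k+1] : (n + k ^ 2) * m ^ k ≤ n * n ^ k
  [n+k^2]*m^k≤n^[k+1] = begin
    (n + k ^ 2) * m ^ k                ≤⟨ *-monoˡ-≤ (m ^ k) n+k^2≤m+[1+k]^2 ⟩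
    (m + suc k * suc k) * m ^ k        ≡⟨ expand m k (m ^ k) ⟩
    m ^ suc k + suc k * suc k * m ^ k  ≤⟨ bernoulli m (suc k) k ⟩
    n * n ^ k                          ∎

[n+k^2]*[n∸[1+k]]Ck≤n*nCk : ∀ n k → (n + k ^ 2) * ((n ∸ suc k) C k) ≤ n * (n C k)
[n+k^2]*[n∸[1+k]]Ck≤n*nCk zero    zero    = z≤n
[n+k^2]*[n∸[1+k]]Ck≤n*nCk zero    (suc k) = ≤-reflexive (*-zeroʳ (suc k ^ 2))
[n+k^2]*[n∸[1+k]]Ck≤n*nCk (suc m) k with k ≤? m
... | yes k≤m = [n+k^2]*mCk≤n*nCk (trans (+-suc (m ∸ k) k) (cong suc (m∸n+n≡m k≤m)))
... | no k≰m  = ≤-trans (≤-reflexive lhs≡0) z≤n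
  where
  lhs≡0 : (suc m + k ^ 2) * ((m ∸ k) C k) ≡ 0
  lhs≡0 rewrite k>n⇒nCk≡0 (≤-<-trans (m∸n≤m m k) (≰⇒> k≰m)) = *-zeroʳ (suc m + k ^ 2)

-- Counting with lists

module _ {a} {A : Set a} where

  ∈-─ : ∀ {x y : A} {ys} (x∈ys : x ∈ₗ ys) → y ∈ₗ ys → y ≢ x → y ∈ₗ (ys ─ x∈ys)
  ∈-─ (here refl)  (here refl)  y≢x = ⊥-elim (y≢x refl)
  ∈-─ (here _)     (there y∈ys) _   = y∈ys
  ∈-─ (there _)    (here y≡z)   _   = here y≡z
  ∈-─ (there x∈ys) (there y∈ys) y≢x = there (∈-─ x∈ys y∈ys y≢x)

  Unique-⊆⇒length-≤ : ∀ {xs ys : List A} → Unique xs → xs ⊆ ys → length xs ≤ length ys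
  Unique-⊆⇒length-≤ {[]}     _               _     = z≤n
  Unique-⊆⇒length-≤ {x ∷ xs} {ys} (x∉xs ∷ unique) xs⊆ys = begin
    suc (length xs)           ≤⟨ s≤s (Unique-⊆⇒length-≤ unique xs⊆ys─x) ⟩
    suc (length (ys ─ x∈ys))  ≡⟨ length-removeAt′ ys _ ⟨
    length ys                 ∎
    where
    open ≤-Reasoning
    x∈ys : x ∈ₗ ys
    x∈ys = xs⊆ys (here refl)
    xs⊆ys─x : xs ⊆ (ys ─ x∈ys)
    xs⊆ys─x y∈xs = ∈-─ x∈ys (xs⊆ys (there y∈xs)) (λ y≡x → All.lookup x∉xs y∈xs (sym y≡x))

  length-filterᵇ-map : ∀ {b} {B : Set b} (p : B → Bool) (f : A → B) xs →
                       length (filterᵇ p (map f xs)) ≡ length (filterᵇ (p ∘ f) xs)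
  length-filterᵇ-map p f []       = refl
  length-filterᵇ-map p f (x ∷ xs) with p (f x)
  ... | true  = cong suc (length-filterᵇ-map p f xs)
  ... | false = length-filterᵇ-map p f xs

  length-filterᵇ-++ : ∀ (p : A → Bool) xs ys →
                      length (filterᵇ p (xs ++ ys)) ≡ length (filterᵇ p xs) + length (filterᵇ p ys)
  length-filterᵇ-++ p xs ys = trans (cong length (filter-++ (T? ∘ p) xs ys)) (length-++ (filterᵇ p xs))

  length-filterᵇ-false : ∀ (xs : List A) → length (filterᵇ (λ _ → false) xs) ≡ 0
  length-filterᵇ-false []       = refl
  length-filterᵇ-false (x ∷ xs) = length-filterᵇ-false xs

  length-filterᵇ+length-filterᵇ-not : ∀ (p : A → Bool) xs →
    length (filterᵇ p xs) + length (filterᵇ (not ∘ p) xs) ≡ length xs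
  length-filterᵇ+length-filterᵇ-not p []       = refl
  length-filterᵇ+length-filterᵇ-not p (x ∷ xs) with p x
  ... | true  = cong suc (length-filterᵇ+length-filterᵇ-not p xs)
  ... | false = trans (+-suc _ _) (cong suc (length-filterᵇ+length-filterᵇ-not p xs))

subsetsOfSize : (n k : ℕ) → List (Subset n)
subsetsOfSize n       zero    = ⊥ ∷ []
subsetsOfSize zero    (suc k) = []
subsetsOfSize (suc n) (suc k) = map (outside ∷_) (subsetsOfSize n (suc k)) ++ map (inside ∷_) (subsetsOfSize n k)

length-subsetsOfSize : ∀ n k → length (subsetsOfSize n k) ≡ n C k
length-subsetsOfSize n       zero    = refl
length-subsetsOfSize zero    (suc k) = refl
length-subsetsOfSize (suc n) (suc k) = begin
  length (map (outside ∷_) (subsetsOfSize n (suc k)) ++ map (inside ∷_) (subsetsOfSize n k))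
    ≡⟨ length-++ (map (outside ∷_) (subsetsOfSize n (suc k))) ⟩
  length (map (outside ∷_) (subsetsOfSize n (suc k))) + length (map (inside ∷_) (subsetsOfSize n k))
    ≡⟨ cong₂ _+_ (length-map _ (subsetsOfSize n (suc k))) (length-map _ (subsetsOfSize n k)) ⟩
  length (subsetsOfSize n (suc k)) + length (subsetsOfSize n k)
    ≡⟨ cong₂ _+_ (length-subsetsOfSize n (suc k)) (length-subsetsOfSize n k) ⟩
  (n C suc k) + (n C k)
    ≡⟨ +-comm (n C suc k) (n C k) ⟩
  (n C k) + (n C suc k)
    ≡⟨ nCk+nC[k+1]≡[n+1]C[k+1] n k ⟩
  suc n C suc k
    ∎
  where open ≡-Reasoning

subsetsOfSize-size : ∀ n k → All (λ S → ∣ S ∣ ≡ k) (subsetsOfSize n k)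
subsetsOfSize-size n       zero    = ∣⊥∣≡0 n ∷ []
subsetsOfSize-size zero    (suc k) = []
subsetsOfSize-size (suc n) (suc k) =
  All.++⁺ (All.map⁺ (subsetsOfSize-size n (suc k))) (All.map⁺ (All.map (cong suc) (subsetsOfSize-size n k)))

subsetsOfSize-unique : ∀ n k → Unique (subsetsOfSize n k)
subsetsOfSize-unique n       zero    = [] ∷ []
subsetsOfSize-unique zero    (suc k) = []
subsetsOfSize-unique (suc n) (suc k) =
  Unique.++⁺ (Unique.map⁺ ∷-injectiveʳ (subsetsOfSize-unique n (suc k)))
             (Unique.map⁺ ∷-injectiveʳ (subsetsOfSize-unique n k))
             outside≢inside
  where
  outside≢inside : Disjoint (map (outside ∷_) (subsetsOfSize n (suc k))) (map (inside ∷_) (subsetsOfSize n k))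
  outside≢inside (S∈outsides , S∈insides)
    with ∈-map⁻ (outside ∷_) S∈outsides | ∈-map⁻ (inside ∷_) S∈insides
  ... | _ , _ , refl | _ , _ , ()

countSubsets : (n : ℕ) → (Subset n → Bool) → ℕ → ℕ
countSubsets n p k = length (filterᵇ p (subsetsOfSize n k))

countSubsets-suc : ∀ n (p : Subset (suc n) → Bool) k →
  countSubsets (suc n) p (suc k) ≡
  countSubsets n (p ∘ (outside ∷_)) (suc k) + countSubsets n (p ∘ (inside ∷_)) k
countSubsets-suc n p k = begin
  length (filterᵇ p (outsides ++ insides))
    ≡⟨ length-filterᵇ-++ p outsides insides ⟩
  length (filterᵇ p outsides) + length (filterᵇ p insides)
    ≡⟨ cong₂ _+_ (length-filterᵇ-map p _ (subsetsOfSize n (suc k)))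
                 (length-filterᵇ-map p _ (subsetsOfSize n k)) ⟩
  countSubsets n (p ∘ (outside ∷_)) (suc k) + countSubsets n (p ∘ (inside ∷_)) k
    ∎
  where
  open ≡-Reasoning
  outsides insides : List (Subset (suc n))
  outsides = map (outside ∷_) (subsetsOfSize n (suc k))
  insides  = map (inside ∷_) (subsetsOfSize n k)

countSubsets-false : ∀ n k → countSubsets n (λ _ → false) k ≡ 0
countSubsets-false n k = length-filterᵇ-false (subsetsOfSize n k)

countSubsets-vanishes : ∀ n {k} (p : Subset n → Bool) → n < k → countSubsets n p k ≡ 0
countSubsets-vanishes n {k} p n<k = n≤0⇒n≡0 (begin
  countSubsets n p k          ≤⟨ length-filter (T? ∘ p) (subsetsOfSize n k) ⟩
  length (subsetsOfSize n k)  ≡⟨ length-subsetsOfSize n k ⟩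
  n C k                       ≡⟨ k>n⇒nCk≡0 n<k ⟩
  0                           ∎)
  where open ≤-Reasoning

-- Stalled sets

sparse : ∀ {n} → Subset n → Bool
sparse []                     = true
sparse (outside ∷ S)          = sparse S
sparse (inside ∷ [])          = false
sparse (inside ∷ inside ∷ S)  = false
sparse (inside ∷ outside ∷ S) = sparse S

stalled : ∀ {n} → Subset n → Bool
stalled []            = true
stalled (inside ∷ _)  = false
stalled (outside ∷ S) = sparse S

sparse-⊥ : ∀ n → sparse (⊥ {n}) ≡ true
sparse-⊥ zero    = refl
sparse-⊥ (suc n) = sparse-⊥ n

countSubsets-sparse-after-inside : ∀ n k →
  countSubsets (suc n) (sparse ∘ (inside ∷_)) k ≡ countSubsets n sparse k
countSubsets-sparse-after-inside n zero    rewrite sparse-⊥ n = refl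
countSubsets-sparse-after-inside n (suc k) = begin
  countSubsets (suc n) (sparse ∘ (inside ∷_)) (suc k)
    ≡⟨ countSubsets-suc n (sparse ∘ (inside ∷_)) k ⟩
  countSubsets n sparse (suc k) + countSubsets n (λ _ → false) k
    ≡⟨ cong (countSubsets n sparse (suc k) +_) (countSubsets-false n k) ⟩
  countSubsets n sparse (suc k) + 0
    ≡⟨ +-identityʳ _ ⟩
  countSubsets n sparse (suc k)
    ∎
  where open ≡-Reasoning

countSubsets-sparse-+ : ∀ j k → countSubsets (j + k) sparse k ≡ j C k
countSubsets-sparse-+ j zero rewrite +-identityʳ j | sparse-⊥ j = refl
countSubsets-sparse-+ zero (suc k) = begin
  countSubsets (suc k) sparse (suc k)
    ≡⟨ countSubsets-suc k sparse k ⟩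
  countSubsets k sparse (suc k) + countSubsets k (sparse ∘ (inside ∷_)) k
    ≡⟨ cong₂ _+_ (countSubsets-vanishes k sparse ≤-refl) (after-inside-diagonal k) ⟩
  0
    ∎
  where
  open ≡-Reasoning
  after-inside-diagonal : ∀ k → countSubsets k (sparse ∘ (inside ∷_)) k ≡ 0
  after-inside-diagonal zero    = refl
  after-inside-diagonal (suc k) =
    trans (countSubsets-sparse-after-inside k (suc k)) (countSubsets-vanishes k sparse ≤-refl)
countSubsets-sparse-+ (suc j) (suc k) = begin
  countSubsets (suc j + suc k) sparse (suc k)
    ≡⟨ countSubsets-suc (j + suc k) sparse k ⟩
  countSubsets (j + suc k) sparse (suc k) + countSubsets (j + suc k) (sparse ∘ (inside ∷_)) k
    ≡⟨ cong₂ _+_ (countSubsets-sparse-+ j (suc k))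
                 (cong (λ n → countSubsets n (sparse ∘ (inside ∷_)) k) (+-suc j k)) ⟩
  (j C suc k) + countSubsets (suc (j + k)) (sparse ∘ (inside ∷_)) k
    ≡⟨ cong ((j C suc k) +_) (trans (countSubsets-sparse-after-inside (j + k) k) (countSubsets-sparse-+ j k)) ⟩
  (j C suc k) + (j C k)
    ≡⟨ +-comm (j C suc k) (j C k) ⟩
  (j C k) + (j C suc k)
    ≡⟨ nCk+nC[k+1]≡[n+1]C[k+1] j k ⟩
  suc j C suc k
    ∎
  where open ≡-Reasoning

countSubsets-sparse : ∀ n k → countSubsets n sparse k ≡ (n ∸ k) C k
countSubsets-sparse n k with k ≤? n
... | yes k≤n = begin
  countSubsets n sparse k            ≡⟨ cong (λ x → countSubsets x sparse k) (m∸n+n≡m k≤n) ⟨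
  countSubsets (n ∸ k + k) sparse k  ≡⟨ countSubsets-sparse-+ (n ∸ k) k ⟩
  (n ∸ k) C k                        ∎
  where open ≡-Reasoning
... | no k≰n = trans (countSubsets-vanishes n sparse n<k) (sym (k>n⇒nCk≡0 (≤-<-trans (m∸n≤m n k) n<k)))
  where
  n<k : n < k
  n<k = ≰⇒> k≰n

countSubsets-stalled : ∀ n k → countSubsets (suc n) stalled k ≡ (n ∸ k) C k
countSubsets-stalled n zero    rewrite sparse-⊥ n = refl
countSubsets-stalled n (suc k) = begin
  countSubsets (suc n) stalled (suc k)
    ≡⟨ countSubsets-suc n stalled k ⟩
  countSubsets n sparse (suc k) + countSubsets n (λ _ → false) k
    ≡⟨ cong₂ _+_ (countSubsets-sparse n (suc k)) (countSubsets-false n k) ⟩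
  (n ∸ suc k) C suc k + 0
    ≡⟨ +-identityʳ _ ⟩
  (n ∸ suc k) C suc k
    ∎
  where open ≡-Reasoning

-- Forcing along a path

-- Vertices are addressed by natural numbers; positions past the end read as outside.
colour : ∀ {n} → Subset n → ℕ → Side
colour []      _       = outside
colour (x ∷ S) zero    = x
colour (x ∷ S) (suc j) = colour S j

Blue : ∀ {n} → Subset n → ℕ → Set
Blue S j = colour S j ≡ inside

colour-toℕ : ∀ {n} (S : Subset n) (x : Fin n) → colour S (toℕ x) ≡ lookup S x
colour-toℕ (_ ∷ S) fzero    = refl
colour-toℕ (_ ∷ S) (fsuc x) = colour-toℕ S x

Blue⇒∈ : ∀ {n} {S : Subset n} {x} → Blue S (toℕ x) → x ∈ S
Blue⇒∈ {S = S} {x} blue = lookup⇒[]= x S (trans (sym (colour-toℕ S x)) blue)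

White⇒∉ : ∀ {n} {S : Subset n} {x} → colour S (toℕ x) ≡ outside → x ∉ S
White⇒∉ {S = S} {x} white x∈S with trans (sym white) (trans (colour-toℕ S x) ([]=⇒lookup x∈S))
... | ()

Blue⇒< : ∀ {n} (S : Subset n) j → Blue S j → j < n
Blue⇒< (_ ∷ S) zero    _    = z<s
Blue⇒< (_ ∷ S) (suc j) blue = s<s (Blue⇒< S j blue)

Blue-≔-self : ∀ {n} (S : Subset n) v → Blue (S [ v ]≔ inside) (toℕ v)
Blue-≔-self (_ ∷ S) fzero    = refl
Blue-≔-self (_ ∷ S) (fsuc v) = Blue-≔-self S v

Blue-≔ : ∀ {n} (S : Subset n) v {j} → Blue S j → Blue (S [ v ]≔ inside) j
Blue-≔ (_ ∷ S) fzero    {zero}  _    = refl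
Blue-≔ (_ ∷ S) fzero    {suc j} blue = blue
Blue-≔ (_ ∷ S) (fsuc v) {zero}  blue = blue
Blue-≔ (_ ∷ S) (fsuc v) {suc j} blue = Blue-≔ S v blue

all-Blue⇒⊤ : ∀ {n} (S : Subset n) → (∀ j → j < n → Blue S j) → S ≡ ⊤
all-Blue⇒⊤ []      _    = refl
all-Blue⇒⊤ (x ∷ S) blue = cong₂ _∷_ (blue 0 z<s) (all-Blue⇒⊤ S (λ j j<n → blue (suc j) (s<s j<n)))

BlueOn : ∀ {n} → Subset n → ℕ → ℕ → Set
BlueOn S a b = ∀ j → a ≤ j → j ≤ b → Blue S j

BlueOn-singleton : ∀ {n} (S : Subset n) {a} → Blue S a → BlueOn S a a
BlueOn-singleton _ blue j a≤j j≤a rewrite ≤-antisym j≤a a≤j = blue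

BlueOn-snoc : ∀ {n} (S : Subset n) {a b} → BlueOn S a b → Blue S (suc b) → BlueOn S a (suc b)
BlueOn-snoc _ blue blue-b j a≤j j≤b+1 with m≤n⇒m<n∨m≡n j≤b+1
... | inj₁ j≤b  = blue j a≤j (s≤s⁻¹ j≤b)
... | inj₂ refl = blue-b

BlueOn-cons : ∀ {n} (S : Subset n) {a b} → Blue S a → BlueOn S (suc a) b → BlueOn S a b
BlueOn-cons _ blue-a blue j a≤j j≤b with m≤n⇒m<n∨m≡n a≤j
... | inj₁ a<j  = blue j a<j j≤b
... | inj₂ refl = blue-a

BlueOn-≔ : ∀ {n} (S : Subset n) v {a b} → BlueOn S a b → BlueOn (S [ v ]≔ inside) a b
BlueOn-≔ S v blue j a≤j j≤b = Blue-≔ S v (blue j a≤j j≤b)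

forceRightward : ∀ {n} {S : Subset n} (u v : Fin n) → suc (toℕ u) ≡ toℕ v → u ∈ S → v ∉ S →
                 (∀ w → suc (toℕ w) ≡ toℕ u → w ∈ S) → Force (Path n) S (S [ v ]≔ inside)
forceRightward u v u→v u∈S v∉S left∈S = force u v u∈S v∉S (inj₁ u→v) others
  where
  others : ∀ w → Path _ u w → w ≢ v → w ∈ _
  others w (inj₁ u→w) w≢v = ⊥-elim (w≢v (toℕ-injective (trans (sym u→w) u→v)))
  others w (inj₂ w→u) _   = left∈S w w→u

forceLeftward : ∀ {n} {S : Subset n} (u v : Fin n) → suc (toℕ v) ≡ toℕ u → u ∈ S → v ∉ S →
                (∀ w → suc (toℕ u) ≡ toℕ w → w ∈ S) → Force (Path n) S (S [ v ]≔ inside)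
forceLeftward u v v→u u∈S v∉S right∈S = force u v u∈S v∉S (inj₂ v→u) others
  where
  others : ∀ w → Path _ u w → w ≢ v → w ∈ _
  others w (inj₁ u→w) _   = right∈S w u→w
  others w (inj₂ w→u) w≢v = ⊥-elim (w≢v (toℕ-injective (suc-injective (trans w→u (sym v→u)))))

AdjacentBlues : ∀ {n} → Subset n → Set
AdjacentBlues S = ∃ λ i → Blue S i × Blue S (suc i)

AdjacentBlues-∷ : ∀ {n} {S : Subset n} x → AdjacentBlues S → AdjacentBlues (x ∷ S)
AdjacentBlues-∷ _ (i , blue-i , blue-i+1) = suc i , blue-i , blue-i+1

sparse≡false : ∀ {n} x (S : Subset n) → sparse S ≡ false → Blue (x ∷ S) n ⊎ AdjacentBlues (x ∷ S)
sparse≡false x (outside ∷ S)          ¬sparse = map₂ (AdjacentBlues-∷ x) (sparse≡false outside S ¬sparse)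
sparse≡false x (inside ∷ [])          _       = inj₁ refl
sparse≡false x (inside ∷ inside ∷ S)  _       = inj₂ (1 , refl , refl)
sparse≡false x (inside ∷ outside ∷ S) ¬sparse =
  map₂ (AdjacentBlues-∷ x ∘ AdjacentBlues-∷ inside) (sparse≡false outside S ¬sparse)

module _ (m : ℕ) where

  _⇝*_ : Subset (suc m) → Subset (suc m) → Set
  _⇝*_ = Star (Force (Path (suc m)))

  -- a ≤ pred b says that the left neighbour of b, if there is one, is blue, so b can force b + 1.
  growRight : ∀ {S a b} → b < m → BlueOn S a b → a ≤ pred b → ∃ λ S′ → S ⇝* S′ × BlueOn S′ a (suc b)
  growRight {S} {a} {b} b<m blue a≤b-1 with colour S (suc b) in b+1-colour
  ... | inside  = S , ε , BlueOn-snoc S blue b+1-colour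
  ... | outside = S [ v ]≔ inside , forceRightward u v u→v u∈S v∉S left∈S ◅ ε ,
                  BlueOn-snoc (S [ v ]≔ inside) (BlueOn-≔ S v blue)
                              (subst (Blue (S [ v ]≔ inside)) v≡b+1 (Blue-≔-self S v))
    where
    u v : Fin (suc m)
    u = fromℕ< (m<n⇒m<1+n b<m)
    v = fromℕ< (s<s b<m)
    u≡b : toℕ u ≡ b
    u≡b = toℕ-fromℕ< (m<n⇒m<1+n b<m)
    v≡b+1 : toℕ v ≡ suc b
    v≡b+1 = toℕ-fromℕ< (s<s b<m)
    u→v : suc (toℕ u) ≡ toℕ v
    u→v = trans (cong suc u≡b) (sym v≡b+1)
    u∈S : u ∈ S
    u∈S = Blue⇒∈ (subst (Blue S) (sym u≡b) (blue b (≤pred⇒≤ a≤b-1) ≤-refl))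
    v∉S : v ∉ S
    v∉S = White⇒∉ (subst (λ j → colour S j ≡ outside) (sym v≡b+1) b+1-colour)
    left∈S : ∀ w → suc (toℕ w) ≡ toℕ u → w ∈ S
    left∈S w w→u =
      Blue⇒∈ (blue (toℕ w) (subst (λ x → a ≤ pred x) (sym w→b) a≤b-1) (≤-trans (n≤1+n _) (≤-reflexive w→b)))
      where
      w→b : suc (toℕ w) ≡ b
      w→b = trans w→u u≡b

  growLeft : ∀ {S a} → a < m → BlueOn S (suc a) m → ∃ λ S′ → S ⇝* S′ × BlueOn S′ a m
  growLeft {S} {a} a<m blue with colour S a in a-colour
  ... | inside  = S , ε , BlueOn-cons S a-colour blue
  ... | outside = S [ v ]≔ inside , forceLeftward u v v→u u∈S v∉S right∈S ◅ ε ,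
                  BlueOn-cons (S [ v ]≔ inside) (subst (Blue (S [ v ]≔ inside)) v≡a (Blue-≔-self S v))
                              (BlueOn-≔ S v blue)
    where
    u v : Fin (suc m)
    u = fromℕ< (s<s a<m)
    v = fromℕ< (m<n⇒m<1+n a<m)
    u≡a+1 : toℕ u ≡ suc a
    u≡a+1 = toℕ-fromℕ< (s<s a<m)
    v≡a : toℕ v ≡ a
    v≡a = toℕ-fromℕ< (m<n⇒m<1+n a<m)
    v→u : suc (toℕ v) ≡ toℕ u
    v→u = trans (cong suc v≡a) (sym u≡a+1)
    u∈S : u ∈ S
    u∈S = Blue⇒∈ (subst (Blue S) (sym u≡a+1) (blue (suc a) ≤-refl a<m))
    v∉S : v ∉ S
    v∉S = White⇒∉ (subst (λ j → colour S j ≡ outside) (sym v≡a) a-colour)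
    right∈S : ∀ w → suc (toℕ u) ≡ toℕ w → w ∈ S
    right∈S w u→w = Blue⇒∈ (blue (toℕ w) a≤w (s≤s⁻¹ (toℕ<n w)))
      where
      a≤w : suc a ≤ toℕ w
      a≤w = ≤-trans (n≤1+n _) (≤-reflexive (trans (cong suc (sym u≡a+1)) u→w))

  sweepRight : ∀ d {S a b} → b + d ≡ m → BlueOn S a b → a ≤ pred b → ∃ λ S′ → S ⇝* S′ × BlueOn S′ a m
  sweepRight zero    {S} {b = b} b+0≡m blue _ =
    S , ε , subst (BlueOn S _) (trans (sym (+-identityʳ b)) b+0≡m) blue
  sweepRight (suc d) {b = b} b+d+1≡m blue a≤b-1 with growRight b<m blue a≤b-1
    where
    b<m : b < m
    b<m = subst (b <_) b+d+1≡m (m<m+n b z<s)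
  ... | S′ , S⇝S′ , blue′ with sweepRight d (trans (sym (+-suc b d)) b+d+1≡m) blue′ (≤pred⇒≤ a≤b-1)
  ... | S″ , S′⇝S″ , blue″ = S″ , S⇝S′ ◅◅ S′⇝S″ , blue″

  sweepLeft : ∀ a {S} → a ≤ m → BlueOn S a m → ∃ λ S′ → S ⇝* S′ × BlueOn S′ 0 m
  sweepLeft zero    {S} _ blue = S , ε , blue
  sweepLeft (suc a) a+1≤m blue with growLeft a+1≤m blue
  ... | S′ , S⇝S′ , blue′ with sweepLeft a (<⇒≤ a+1≤m) blue′
  ... | S″ , S′⇝S″ , blue″ = S″ , S⇝S′ ◅◅ S′⇝S″ , blue″

  blueSuffix⇒zeroForcing : ∀ {S a} → a ≤ m → BlueOn S a m → IsZeroForcingSet (Path (suc m)) S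
  blueSuffix⇒zeroForcing {S} a≤m blue with sweepLeft _ a≤m blue
  ... | S′ , S⇝S′ , blue′ = subst (S ⇝*_) (all-Blue⇒⊤ S′ (λ j j<n → blue′ j z≤n (s≤s⁻¹ j<n))) S⇝S′

  blueInterval⇒zeroForcing : ∀ {S a b} → b ≤ m → BlueOn S a b → a ≤ pred b →
                             IsZeroForcingSet (Path (suc m)) S
  blueInterval⇒zeroForcing {b = b} b≤m blue a≤b-1
    with sweepRight (m ∸ b) (m+[n∸m]≡n b≤m) blue a≤b-1
  ... | S′ , S⇝S′ , blue′ = S⇝S′ ◅◅ blueSuffix⇒zeroForcing (≤-trans (≤pred⇒≤ a≤b-1) b≤m) blue′

  nonstalled⇒zeroForcing : ∀ S → stalled S ≡ false → IsZeroForcingSet (Path (suc m)) S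
  nonstalled⇒zeroForcing S@(inside ∷ _)  _ = blueInterval⇒zeroForcing z≤n (BlueOn-singleton S refl) z≤n
  nonstalled⇒zeroForcing S@(outside ∷ T) ¬sparse with sparse≡false outside T ¬sparse
  ... | inj₁ blue-m = blueSuffix⇒zeroForcing ≤-refl (BlueOn-singleton S blue-m)
  ... | inj₂ (i , blue-i , blue-i+1) =
    blueInterval⇒zeroForcing (s≤s⁻¹ (Blue⇒< S (suc i) blue-i+1))
                             (BlueOn-snoc S (BlueOn-singleton S blue-i) blue-i+1) ≤-refl

bound-via-complement : ∀ {n q b g c N} → b + g ≡ c → g ≤ N → (n + q) * b ≤ n * c → q * c ≤ (n + q) * N
bound-via-complement {n} {q} {b} {g} {c} {N} b+g≡c g≤N b-bound = +-cancelˡ-≤ (n * c) _ _ (begin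
  n * c + q * c                ≡⟨ *-distribʳ-+ c n q ⟨
  (n + q) * c                  ≡⟨ cong ((n + q) *_) b+g≡c ⟨
  (n + q) * (b + g)            ≡⟨ *-distribˡ-+ (n + q) b g ⟩
  (n + q) * b + (n + q) * g    ≤⟨ +-mono-≤ b-bound (*-monoʳ-≤ (n + q) g≤N) ⟩
  n * c + (n + q) * N          ∎)
  where open ≤-Reasoning

lemma3p5 : (n k N : ℕ) → 1 ≤ n → IsZCount (Path n) k N →
    k ^ 2 * (n C k) ≤ (n + k ^ 2) * N
lemma3p5 (suc m) k _ _ (Zs , _ , refl , Zs-spec) =
  bound-via-complement {n = suc m} {q = k ^ 2} partition nonstalled≤Zs stalled-bound
  where
  n : ℕ
  n = suc m
  nonstalled : List (Subset n)
  nonstalled = filterᵇ (not ∘ stalled) (subsetsOfSize n k)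
  partition : countSubsets n stalled k + length nonstalled ≡ n C k
  partition = trans (length-filterᵇ+length-filterᵇ-not stalled (subsetsOfSize n k)) (length-subsetsOfSize n k)
  stalled-bound : (n + k ^ 2) * countSubsets n stalled k ≤ n * (n C k)
  stalled-bound rewrite countSubsets-stalled m k = [n+k^2]*[n∸[1+k]]Ck≤n*nCk n k
  nonstalled⊆Zs : nonstalled ⊆ Zs
  nonstalled⊆Zs S∈nonstalled with ∈-filter⁻ (T? ∘ not ∘ stalled) S∈nonstalled
  ... | S∈subsets , ¬stalled = Equivalence.from (Zs-spec _)
    (All.lookup (subsetsOfSize-size n k) S∈subsets ,
     nonstalled⇒zeroForcing m _ (Equivalence.to T-not-≡ ¬stalled))
  nonstalled≤Zs : length nonstalled ≤ length Zs
  nonstalled≤Zs =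
    Unique-⊆⇒length-≤ (Unique.filter⁺ (T? ∘ not ∘ stalled) (subsetsOfSize-unique n k)) nonstalled⊆Zs
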